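{- Let $K$ be a field with $\mathrm{char}(K)\ne2,3$, $\Delta\in K^*$, $L=K[\delta]$ with $\delta^2=-3\Delta$, and let $g$ be a binary cubic form over $K$ of discriminant $\Delta$, with Hessian $H$ and Cardano covariant $C$. Then for $(x,y)\in K\times K$ with $H(x,y)\neq0$, $C(x,y)$ is a unit of $L$, and its class in $L^*/L^{*3}$ is independent of such $(x,y)$.
   Context: For $g=aX^3+bX^2Y+cXY^2+dY^3$: discriminant $b^2c^2-4ac^3-4b^3d-27a^2d^2+18abcd$; Hessian $H(X,Y)=(b^2-3ac)X^2+(bc-9ad)XY+(c^2-3bd)Y^2$; cubic covariant $G(X,Y)=(2b^3+27a^2d-9abc)X^3+3(b^2c+9abd-6ac^2)X^2Y-3(bc^2+9acd-6b^2d)XY^2-(2c^3+27ad^2-9bcd)Y^3$. $L=K[T]/(T^2+3\Delta)$, $\delta$ the image of $T$, $L^*$ the unit group. The Cardano covariant is $C=\tfrac12(G+3\delta g)\in L[X,Y]$. -}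

module Defs where

open import Level using (_⊔_)
open import Data.Nat using (ℕ; zero; suc)
open import Data.Product using (Σ; ∃; _×_; _,_)
open import Relation.Nullary using (¬_)
open import Algebra.Bundles using (CommutativeRing)

module Cubic {c ℓ} (K : CommutativeRing c ℓ) where
  open CommutativeRing K

  nat : ℕ → Carrier
  nat zero = 0#
  nat (suc n) = 1# + nat n

  IsField : Set (c ⊔ ℓ)
  IsField = (¬ (1# ≈ 0#)) × (∀ x → ¬ (x ≈ 0#) → ∃ λ y → x * y ≈ 1#)

  record BinCubic : Set c where
    constructor form
    field
      a b c' d : Carrier
  open BinCubic public

  eval : BinCubic → Carrier → Carrier → Carrier
  eval g x y = a g * (x * x * x) + b g * (x * x * y) + c' g * (x * y * y) + d g * (y * y * y)

  disc : BinCubic → Carrier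
  disc (form a b c d) =
    b * b * c * c - nat 4 * a * c * c * c - nat 4 * b * b * b * d
    - nat 27 * a * a * d * d + nat 18 * a * b * c * d

  hessian : BinCubic → Carrier → Carrier → Carrier
  hessian (form a b c d) x y =
    (b * b - nat 3 * a * c) * (x * x) + (b * c - nat 9 * a * d) * (x * y)
    + (c * c - nat 3 * b * d) * (y * y)

  covG : BinCubic → BinCubic
  covG (form a b c d) = form
    (nat 2 * b * b * b + nat 27 * a * a * d - nat 9 * a * b * c)
    (nat 3 * (b * b * c + nat 9 * a * b * d - nat 6 * a * c * c))
    (- (nat 3 * (b * c * c + nat 9 * a * c * d - nat 6 * b * b * d)))
    (- (nat 2 * c * c * c + nat 27 * a * d * d - nat 9 * b * c * d))

  -- The algebra L = K[T]/(T² + 3Δ): element u + v δ with δ² = -3Δ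
  record L : Set c where
    constructor _+δ_
    field
      re im : Carrier
  open L public

  module _ (Δ : Carrier) where
    _≈L_ : L → L → Set ℓ
    (u +δ v) ≈L (u' +δ v') = (u ≈ u') × (v ≈ v')

    _*L_ : L → L → L
    (u +δ v) *L (u' +δ v') = (u * u' - nat 3 * Δ * (v * v')) +δ (u * v' + v * u')

    1L : L
    1L = 1# +δ 0#

    IsUnitL : L → Set (c ⊔ ℓ)
    IsUnitL z = ∃ λ w → (z *L w) ≈L 1L

    SameCubeClass : L → L → Set (c ⊔ ℓ)
    SameCubeClass z z' = ∃ λ w → IsUnitL w × (z ≈L (z' *L ((w *L w) *L w)))

  -- Cardano covariant C = ½ (G + 3 δ g) evaluated at (x,y), where `half` is ½ ∈ K
  cardano : Carrier → BinCubic → Carrier → Carrier → L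
  cardano half g x y = (half * eval (covG g) x y) +δ (half * (nat 3 * eval g x y))

{-# OPTIONS --safe #-}
module Submission where

-- Write N(u + vδ) = u² + 3Δv² for the norm of L, so that z · z̄ = N(z).  The syzygy
-- G² + 27Δg² = 4H³ says N(C(x,y)) = H(x,y)³, hence C(x,y) is a unit as soon as H(x,y) is.
-- For a second point (u,v) let B be the polarisation of 2H and W = B((x,y),(u,v)) + (yu − xv)δ.
-- Then N(W) = 4H(x,y)H(u,v) and C(u,v)·W³ = (2H(u,v))³·C(x,y), so C(x,y) and C(u,v)
-- differ by the cube of the unit W / 2H(u,v).

open import Algebra.Bundles using (CommutativeRing)
open import Level using (_⊔_)
open import Data.Integer as ℤ using (ℤ; +_; -[1+_]; _⊖_)
open import Data.Integer.Base using (_◃_)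
import Data.Integer.Properties as ℤ
open import Data.Maybe using (Maybe; just; nothing)
open import Data.Nat as ℕ using (ℕ; zero; suc)
import Data.Nat.Properties as ℕ
open import Data.Product using (_×_; _,_; proj₁; proj₂)
import Data.Sign as Sign
open import Relation.Binary.PropositionalEquality as ≡ using (_≡_)
open import Relation.Nullary using (¬_; yes; no)
import Algebra.Solver.Ring.AlmostCommutativeRing as ACR

open import Defs

-- K has no decidable equality, so the ring solver runs with coefficients in ℤ,
-- mapped into K by n ↦ nat n.
module IntegerCoefficients {c ℓ} (K : CommutativeRing c ℓ) where
  open CommutativeRing K
  open Cubic K using (nat)
  open import Algebra.Properties.Ring ring
    using (-‿involutive; -‿distribˡ-*; -‿distribʳ-*; -‿+-comm; -0#≈0#)
  open import Algebra.Properties.CommutativeSemigroup +-commutativeSemigroup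
    using (interchange)
  open import Algebra.Properties.Semiring.Mult semiring
    using (×-homo-+; ×1-homo-*) renaming (_×_ to _×ᵤ_)
  open import Relation.Binary.Reasoning.Setoid setoid

  nat≡×1# : ∀ n → nat n ≡ n ×ᵤ 1#
  nat≡×1# zero = ≡.refl
  nat≡×1# (suc n) = ≡.cong (_+_ 1#) (nat≡×1# n)

  nat-+ : ∀ m n → nat (m ℕ.+ n) ≈ nat m + nat n
  nat-+ m n rewrite nat≡×1# (m ℕ.+ n) | nat≡×1# m | nat≡×1# n = ×-homo-+ 1# m n

  nat-* : ∀ m n → nat (m ℕ.* n) ≈ nat m * nat n
  nat-* m n rewrite nat≡×1# (m ℕ.* n) | nat≡×1# m | nat≡×1# n = ×1-homo-* m n

  ⟦_⟧ℤ : ℤ → Carrier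
  ⟦ + n ⟧ℤ = nat n
  ⟦ -[1+ n ] ⟧ℤ = - nat (suc n)

  ⟦⟧-⊖ : ∀ m n → ⟦ m ⊖ n ⟧ℤ ≈ nat m - nat n
  ⟦⟧-⊖ m zero = sym (trans (+-congˡ -0#≈0#) (+-identityʳ _))
  ⟦⟧-⊖ zero (suc n) = sym (+-identityˡ _)
  ⟦⟧-⊖ (suc m) (suc n) = begin
    ⟦ suc m ⊖ suc n ⟧ℤ                 ≡⟨ ≡.cong ⟦_⟧ℤ (ℤ.[1+m]⊖[1+n]≡m⊖n m n) ⟩
    ⟦ m ⊖ n ⟧ℤ                         ≈⟨ ⟦⟧-⊖ m n ⟩
    nat m - nat n                      ≈⟨ +-identityˡ _ ⟨
    0# + (nat m - nat n)               ≈⟨ +-congʳ (-‿inverseʳ 1#) ⟨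
    (1# - 1#) + (nat m - nat n)        ≈⟨ interchange _ _ _ _ ⟩
    (1# + nat m) + (- 1# - nat n)      ≈⟨ +-congˡ (-‿+-comm 1# (nat n)) ⟩
    (1# + nat m) - (1# + nat n)        ∎

  ⟦⟧-+ : ∀ i j → ⟦ i ℤ.+ j ⟧ℤ ≈ ⟦ i ⟧ℤ + ⟦ j ⟧ℤ
  ⟦⟧-+ (+ m) (+ n) = nat-+ m n
  ⟦⟧-+ (+ m) -[1+ n ] = ⟦⟧-⊖ m (suc n)
  ⟦⟧-+ -[1+ m ] (+ n) = trans (⟦⟧-⊖ n (suc m)) (+-comm _ _)
  ⟦⟧-+ -[1+ m ] -[1+ n ] = begin
    - nat (suc (suc (m ℕ.+ n)))        ≡⟨ ≡.cong (λ k → - nat (suc k)) (ℕ.+-suc m n) ⟨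
    - nat (suc m ℕ.+ suc n)            ≈⟨ -‿cong (nat-+ (suc m) (suc n)) ⟩
    - (nat (suc m) + nat (suc n))      ≈⟨ -‿+-comm _ _ ⟨
    - nat (suc m) + - nat (suc n)      ∎

  ⟦⟧-neg : ∀ i → ⟦ ℤ.- i ⟧ℤ ≈ - ⟦ i ⟧ℤ
  ⟦⟧-neg (+ zero) = sym -0#≈0#
  ⟦⟧-neg (+ suc n) = refl
  ⟦⟧-neg -[1+ n ] = sym (-‿involutive _)

  ⟦⟧-◃⁺ : ∀ n → ⟦ Sign.+ ◃ n ⟧ℤ ≈ nat n
  ⟦⟧-◃⁺ zero = refl
  ⟦⟧-◃⁺ (suc n) = refl

  ⟦⟧-◃⁻ : ∀ n → ⟦ Sign.- ◃ n ⟧ℤ ≈ - nat n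
  ⟦⟧-◃⁻ zero = sym -0#≈0#
  ⟦⟧-◃⁻ (suc n) = refl

  ⟦⟧-* : ∀ i j → ⟦ i ℤ.* j ⟧ℤ ≈ ⟦ i ⟧ℤ * ⟦ j ⟧ℤ
  ⟦⟧-* (+ m) (+ n) = trans (⟦⟧-◃⁺ (m ℕ.* n)) (nat-* m n)
  ⟦⟧-* (+ m) -[1+ n ] =
    trans (⟦⟧-◃⁻ (m ℕ.* suc n)) (trans (-‿cong (nat-* m (suc n))) (-‿distribʳ-* _ _))
  ⟦⟧-* -[1+ m ] (+ n) =
    trans (⟦⟧-◃⁻ (suc m ℕ.* n)) (trans (-‿cong (nat-* (suc m) n)) (-‿distribˡ-* _ _))
  ⟦⟧-* -[1+ m ] -[1+ n ] = begin
    nat (suc m ℕ.* suc n)              ≈⟨ nat-* (suc m) (suc n) ⟩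
    nat (suc m) * nat (suc n)          ≈⟨ -‿involutive _ ⟨
    - - (nat (suc m) * nat (suc n))    ≈⟨ -‿cong (-‿distribˡ-* _ _) ⟩
    - (- nat (suc m) * nat (suc n))    ≈⟨ -‿distribʳ-* _ _ ⟩
    - nat (suc m) * - nat (suc n)      ∎

  ⟦⟧-homomorphism : ℤ.+-*-rawRing ACR.-Raw-AlmostCommutative⟶ ACR.fromCommutativeRing K
  ⟦⟧-homomorphism = record
    { ⟦_⟧ = ⟦_⟧ℤ ; +-homo = ⟦⟧-+ ; *-homo = ⟦⟧-* ; -‿homo = ⟦⟧-neg
    ; 0-homo = refl ; 1-homo = +-identityʳ 1# }

  ⟦⟧-≟ : ∀ i j → Maybe (⟦ i ⟧ℤ ≈ ⟦ j ⟧ℤ)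
  ⟦⟧-≟ i j with i ℤ.≟ j
  ... | yes ≡.refl = just refl
  ... | no _ = nothing

  open import Algebra.Solver.Ring ℤ.+-*-rawRing (ACR.fromCommutativeRing K) ⟦⟧-homomorphism ⟦⟧-≟ public

module CardanoCovariant {c ℓ} (K : CommutativeRing c ℓ) where
  open CommutativeRing K
  open Cubic K
  open IntegerCoefficients K
  open import Algebra.Definitions _≈_ using (RightInvertible)
  open import Algebra.Properties.CommutativeSemigroup *-commutativeSemigroup using (interchange)

  conj : L → L
  conj (u +δ v) = u +δ (- v)

  norm : Carrier → L → Carrier
  norm Δ (u +δ v) = u * u + nat 3 * Δ * (v * v)

  infixr 7 _·L_
  _·L_ : Carrier → L → L
  s ·L (u +δ v) = (s * u) +δ (s * v)

  cubeL : Carrier → L → L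
  cubeL Δ w = _*L_ Δ (_*L_ Δ w w) w

  hessianPolar : BinCubic → Carrier → Carrier → Carrier → Carrier → Carrier
  hessianPolar (form a b c d) x y u v =
    nat 2 * (b * b - nat 3 * a * c) * (x * u) + (b * c - nat 9 * a * d) * (x * v + y * u)
    + nat 2 * (c * c - nat 3 * b * d) * (y * v)

  polarL : BinCubic → Carrier → Carrier → Carrier → Carrier → L
  polarL g x y u v = hessianPolar g x y u v +δ (y * u - x * v)

  -- `_≈L_ Δ` does not depend on Δ, so these lemmas need Δ passed explicitly.
  module _ {Δ : Carrier} where
    ≈L-refl : ∀ {z} → _≈L_ Δ z z
    ≈L-refl {u +δ v} = refl , refl

    ≈L-sym : ∀ {z w} → _≈L_ Δ z w → _≈L_ Δ w z
    ≈L-sym {u +δ v} {u' +δ v'} (p , q) = sym p , sym q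

    ≈L-trans : ∀ {z w t} → _≈L_ Δ z w → _≈L_ Δ w t → _≈L_ Δ z t
    ≈L-trans {u +δ v} {u' +δ v'} {u'' +δ v''} (p , q) (p' , q') = trans p p' , trans q q'

    ·L-identity : ∀ {s} z → s ≈ 1# → _≈L_ Δ (s ·L z) z
    ·L-identity (u +δ v) s≈1 =
      trans (*-congʳ s≈1) (*-identityˡ u) , trans (*-congʳ s≈1) (*-identityˡ v)

  *L-cong : ∀ {Δ Δ' z z' w w'} → Δ ≈ Δ' → _≈L_ Δ z z' → _≈L_ Δ w w' →
            _≈L_ Δ (_*L_ Δ z w) (_*L_ Δ' z' w')
  *L-cong {z = _ +δ _} {_ +δ _} {_ +δ _} {_ +δ _} Δ≈Δ' (p , q) (p' , q') =
    +-cong (*-cong p p') (-‿cong (*-cong (*-congˡ Δ≈Δ') (*-cong q q'))) ,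
    +-cong (*-cong p q') (*-cong q p')

  cubeL-cong : ∀ {Δ Δ'} w → Δ ≈ Δ' → _≈L_ Δ (cubeL Δ w) (cubeL Δ' w)
  cubeL-cong {Δ} w Δ≈Δ' = *L-cong Δ≈Δ' (*L-cong Δ≈Δ' (≈L-refl {Δ}) (≈L-refl {Δ})) (≈L-refl {Δ})

  norm-cong : ∀ {Δ Δ'} z → Δ ≈ Δ' → norm Δ z ≈ norm Δ' z
  norm-cong (u +δ v) Δ≈Δ' = +-congˡ (*-congʳ (*-congˡ Δ≈Δ'))

  IsUnit : Carrier → Set (c ⊔ ℓ)
  IsUnit = RightInvertible 1# _*_

  isUnit-* : ∀ {x y} → IsUnit x → IsUnit y → IsUnit (x * y)
  isUnit-* {x} {y} (x⁻¹ , xx⁻¹≈1) (y⁻¹ , yy⁻¹≈1) =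
    x⁻¹ * y⁻¹ , trans (interchange x y x⁻¹ y⁻¹) (trans (*-cong xx⁻¹≈1 yy⁻¹≈1) (*-identityˡ 1#))

  isUnit-resp-≈ : ∀ {x y} → x ≈ y → IsUnit x → IsUnit y
  isUnit-resp-≈ x≈y (x⁻¹ , xx⁻¹≈1) = x⁻¹ , trans (*-congʳ (sym x≈y)) xx⁻¹≈1

  -- Copies of eval, covG, disc, hessian, cardano and the operations above in the solver's
  -- syntax: their semantics reduce to the original definitions (`con (+ n)` to `nat n`),
  -- so `solve … refl` proves statements phrased with the definitions themselves.
  private
    module Syntax {n : ℕ} where
      P : Set
      P = Polynomial n

      κ : ℕ → P
      κ k = con (+ k)

      evalᴾ : P → P → P → P → P → P → P
      evalᴾ a b c d x y =
        a :* (x :* x :* x) :+ b :* (x :* x :* y) :+ c :* (x :* y :* y) :+ d :* (y :* y :* y)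

      covGᴾ : P → P → P → P → P → P → P
      covGᴾ a b c d = evalᴾ
        (κ 2 :* b :* b :* b :+ κ 27 :* a :* a :* d :- κ 9 :* a :* b :* c)
        (κ 3 :* (b :* b :* c :+ κ 9 :* a :* b :* d :- κ 6 :* a :* c :* c))
        (:- (κ 3 :* (b :* c :* c :+ κ 9 :* a :* c :* d :- κ 6 :* b :* b :* d)))
        (:- (κ 2 :* c :* c :* c :+ κ 27 :* a :* d :* d :- κ 9 :* b :* c :* d))

      discᴾ : P → P → P → P → P
      discᴾ a b c d =
        b :* b :* c :* c :- κ 4 :* a :* c :* c :* c :- κ 4 :* b :* b :* b :* d
        :- κ 27 :* a :* a :* d :* d :+ κ 18 :* a :* b :* c :* d

      hessianᴾ : P → P → P → P → P → P → P
      hessianᴾ a b c d x y =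
        (b :* b :- κ 3 :* a :* c) :* (x :* x) :+ (b :* c :- κ 9 :* a :* d) :* (x :* y)
        :+ (c :* c :- κ 3 :* b :* d) :* (y :* y)

      hessianPolarᴾ : P → P → P → P → P → P → P → P → P
      hessianPolarᴾ a b c d x y u v =
        κ 2 :* (b :* b :- κ 3 :* a :* c) :* (x :* u) :+ (b :* c :- κ 9 :* a :* d) :* (x :* v :+ y :* u)
        :+ κ 2 :* (c :* c :- κ 3 :* b :* d) :* (y :* v)

      Lᴾ : Set
      Lᴾ = P × P

      mulᴾ : P → Lᴾ → Lᴾ → Lᴾ
      mulᴾ Δ (u , v) (u' , v') = (u :* u' :- κ 3 :* Δ :* (v :* v')) , (u :* v' :+ v :* u')

      scaleᴾ : P → Lᴾ → Lᴾ
      scaleᴾ s (u , v) = (s :* u) , (s :* v)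

      conjᴾ : Lᴾ → Lᴾ
      conjᴾ (u , v) = u , (:- v)

      normᴾ : P → Lᴾ → P
      normᴾ Δ (u , v) = u :* u :+ κ 3 :* Δ :* (v :* v)

      cubeᴾ : P → Lᴾ → Lᴾ
      cubeᴾ Δ w = mulᴾ Δ (mulᴾ Δ w w) w

      cardanoᴾ : P → P → P → P → P → P → P → Lᴾ
      cardanoᴾ h a b c d x y = (h :* covGᴾ a b c d x y) , (h :* (κ 3 :* evalᴾ a b c d x y))

      polarᴾ : P → P → P → P → P → P → P → P → Lᴾ
      polarᴾ a b c d x y u v = hessianPolarᴾ a b c d x y u v , (y :* u :- x :* v)

  open Syntax

  *L-scale-conj : ∀ Δ u v t →
    _≈L_ Δ (_*L_ Δ (u +δ v) (t ·L conj (u +δ v))) ((norm Δ (u +δ v) * t) +δ 0#)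
  *L-scale-conj Δ u v t =
    solve 4 (λ Δ u v t → proj₁ (mulᴾ Δ (u , v) (scaleᴾ t (conjᴾ (u , v)))) := normᴾ Δ (u , v) :* t)
      refl Δ u v t ,
    solve 4 (λ Δ u v t → proj₂ (mulᴾ Δ (u , v) (scaleᴾ t (conjᴾ (u , v)))) := κ 0)
      refl Δ u v t

  norm-cardano : ∀ a b c d x y h → let g = form a b c d; H = hessian g x y in
    norm (disc g) (cardano h g x y) ≈ (nat 2 * h) * (nat 2 * h) * (H * H * H)
  norm-cardano = solve 7 (λ a b c d x y h →
    normᴾ (discᴾ a b c d) (cardanoᴾ h a b c d x y)
      := (κ 2 :* h) :* (κ 2 :* h) :* (hessianᴾ a b c d x y :* hessianᴾ a b c d x y :* hessianᴾ a b c d x y))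
    refl

  norm-polar : ∀ a b c d x y u v s → let g = form a b c d in
    norm (disc g) (s ·L polarL g x y u v) ≈ (s * s) * ((nat 2 * hessian g x y) * (nat 2 * hessian g u v))
  norm-polar = solve 9 (λ a b c d x y u v s →
    normᴾ (discᴾ a b c d) (scaleᴾ s (polarᴾ a b c d x y u v))
      := (s :* s) :* ((κ 2 :* hessianᴾ a b c d x y) :* (κ 2 :* hessianᴾ a b c d u v)))
    refl

  cardano-cube-shift : ∀ a b c d x y u v h s →
    let g = form a b c d; Δ = disc g; σ = nat 2 * hessian g u v * s in
    _≈L_ Δ (_*L_ Δ (cardano h g u v) (cubeL Δ (s ·L polarL g x y u v)))
           ((σ * σ * σ) ·L cardano h g x y)
  cardano-cube-shift a b c d x y u v h s =
    solve 10 (λ a b c d x y u v h s →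
      proj₁ (shiftedᴾ a b c d x y u v h s) := proj₁ (rescaledᴾ a b c d x y u v h s)) refl a b c d x y u v h s ,
    solve 10 (λ a b c d x y u v h s →
      proj₂ (shiftedᴾ a b c d x y u v h s) := proj₂ (rescaledᴾ a b c d x y u v h s)) refl a b c d x y u v h s
    where
    shiftedᴾ rescaledᴾ : ∀ {n} → (a b c d x y u v h s : Polynomial n) → Lᴾ
    shiftedᴾ a b c d x y u v h s = let Δ = discᴾ a b c d in
      mulᴾ Δ (cardanoᴾ h a b c d u v) (cubeᴾ Δ (scaleᴾ s (polarᴾ a b c d x y u v)))
    rescaledᴾ a b c d x y u v h s = let σ = κ 2 :* hessianᴾ a b c d u v :* s in
      scaleᴾ (σ :* σ :* σ) (cardanoᴾ h a b c d x y)

  isUnitL-of-isUnit-norm : ∀ {Δ} z → IsUnit (norm Δ z) → IsUnitL Δ z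
  isUnitL-of-isUnit-norm {Δ} (u +δ v) (t , nt≈1) =
    t ·L conj (u +δ v) , trans (proj₁ zz̄t≈nt) nt≈1 , proj₂ zz̄t≈nt
    where zz̄t≈nt = *L-scale-conj Δ u v t

  cardano-isUnitL : ∀ {Δ} g h x y → disc g ≈ Δ →
                    IsUnit (nat 2 * h) → IsUnit (hessian g x y) → IsUnitL Δ (cardano h g x y)
  cardano-isUnitL (form a b c d) h x y disc≈Δ 2h-unit H-unit =
    isUnitL-of-isUnit-norm (cardano h (form a b c d) x y)
      (isUnit-resp-≈ (trans (sym (norm-cardano a b c d x y h)) (norm-cong (cardano h _ x y) disc≈Δ))
        (isUnit-* (isUnit-* 2h-unit 2h-unit) (isUnit-* (isUnit-* H-unit H-unit) H-unit)))

  cardano-sameCubeClass : ∀ {Δ} g h x y u v → disc g ≈ Δ → IsUnit (nat 2) →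
                          IsUnit (hessian g x y) → IsUnit (hessian g u v) →
                          SameCubeClass Δ (cardano h g x y) (cardano h g u v)
  cardano-sameCubeClass {Δ} g@(form a b c d) h x y u v disc≈Δ 2-unit Hxy-unit Huv-unit =
    w , w-unit , ≈L-sym {Δ} (≈L-trans {Δ} shift (·L-identity {Δ} (cardano h g x y) σ³≈1))
    where
    s = proj₁ (isUnit-* 2-unit Huv-unit)
    σ = nat 2 * hessian g u v * s
    σ≈1 : σ ≈ 1#
    σ≈1 = proj₂ (isUnit-* 2-unit Huv-unit)
    σ³≈1 : σ * σ * σ ≈ 1#
    σ³≈1 = trans (*-cong (trans (*-cong σ≈1 σ≈1) (*-identityˡ 1#)) σ≈1) (*-identityˡ 1#)
    w = s ·L polarL g x y u v
    s-unit : IsUnit s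
    s-unit = nat 2 * hessian g u v , trans (*-comm s _) σ≈1
    w-unit : IsUnitL Δ w
    w-unit = isUnitL-of-isUnit-norm w
      (isUnit-resp-≈ (trans (sym (norm-polar a b c d x y u v s)) (norm-cong w disc≈Δ))
        (isUnit-* (isUnit-* s-unit s-unit)
                  (isUnit-* (isUnit-* 2-unit Hxy-unit) (isUnit-* 2-unit Huv-unit))))
    shift : _≈L_ Δ (_*L_ Δ (cardano h g u v) (cubeL Δ w)) ((σ * σ * σ) ·L cardano h g x y)
    shift = ≈L-trans {Δ} (*L-cong (sym disc≈Δ) (≈L-refl {Δ}) (cubeL-cong w (sym disc≈Δ)))
                         (cardano-cube-shift a b c d x y u v h s)

corollary3p3 : ∀ {c ℓ} (K : CommutativeRing c ℓ) →
    let open CommutativeRing K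
        open Cubic K
    in IsField → ¬ (nat 2 ≈ 0#) → ¬ (nat 3 ≈ 0#) →
       (Δ : Carrier) → ¬ (Δ ≈ 0#) →
       (g : BinCubic) → disc g ≈ Δ →
       (half : Carrier) → nat 2 * half ≈ 1# →
       (x y : Carrier) → ¬ (hessian g x y ≈ 0#) →
       IsUnitL Δ (cardano half g x y)
       × (∀ (x' y' : Carrier) → ¬ (hessian g x' y' ≈ 0#) →
            SameCubeClass Δ (cardano half g x y) (cardano half g x' y'))
corollary3p3 K (_ , nonzero⇒unit) _ _ Δ _ g disc≈Δ half 2half≈1 x y Hxy≉0 =
  cardano-isUnitL g half x y disc≈Δ (1# , trans (*-identityʳ _) 2half≈1) (nonzero⇒unit _ Hxy≉0) ,
  λ x' y' Hx'y'≉0 → cardano-sameCubeClass g half x y x' y' disc≈Δ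
                      (half , 2half≈1) (nonzero⇒unit _ Hxy≉0) (nonzero⇒unit _ Hx'y'≉0)
  where
  open CommutativeRing K
  open CardanoCovariant K
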